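{- Let $\ell\le r$ and let $B$ be a Young diagram in an $\ell\times r$ frame with $e=|B|$ boxes. Suppose $B$ has no out-block move and $B$ is not the Young diagram of $L_{\ell,r}(e)$. Then there exists $P\in B$ such that the transpose of $B$ at $P$ is legal and $B^*_P<_L B$.
   Context: A Young diagram in an $\ell\times r$ frame is a subset $B\subseteq[\ell]\times[r]$ such that whenever $(i,j)\in B$ with $i>1$ then $(i-1,j)\in B$, and whenever $(i,j)\in B$ with $j>1$ then $(i,j-1)\in B$. An out-corner of $B$ is a box $P\in B$ with no box of $B$ directly to its right or directly beneath it; an in-corner is a position $Q\in([\ell]\times[r])\setminus B$ such that $B\cup\{Q\}$ is a Young diagram. For $P=(i,j)$ let $s(P)=i+j$. An out-block move exists if there are an out-corner $P$ and an in-corner $P'$ with $s(P)<s(P')$. Writing $e=qr+c$ with $0\le c<r$, the Young diagram of $L_{\ell,r}(e)$ consists of rows $1,\dots,q$ of length $r$ and row $q+1$ of length $c$ (i.e. $\{(i,j): i\le q\}\cup\{(q+1,j): j\le c\}$). For $P=(i,j)\in B$, the transpose at $P$ is $B^*_P=\{(a,b)\in B: a<i\text{ or }b<j\}\cup\{(b-j+i,\ a-i+j): (a,b)\in B,\ a\ge i,\ b\ge j\}$, and it is legal if $B^*_P$ is a Young diagram in the $\ell\times r$ frame. Order pairs by $(a,b)\lesssim(c,d)$ iff $a<c$, or $a=c$ and $b<d$; for Young diagrams, $B<_L B'$ iff the $\lesssim$-minimum of $B\Delta B'$ lies in $B$. -}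

module Defs where

open import Data.Nat using (ℕ; zero; suc; _+_; _*_; _∸_; _≤_; _<_)
open import Data.Bool using (Bool; true; false)
open import Data.Product using (Σ; _×_; _,_; ∃; ∃-syntax)
open import Data.Sum using (_⊎_)
open import Data.List using (List; map; upTo)
open import Data.Nat.ListAction using (sum)
open import Relation.Binary.PropositionalEquality using (_≡_)
open import Relation.Nullary using (¬_)

-- Boxes are pairs (i , j) of natural numbers, 1-indexed: row i, column j.
-- A "shape" is an arbitrary subset of ℕ × ℕ, given as a predicate.
Shape : Set₁
Shape = ℕ → ℕ → Set

-- A decidable finite subset, given by its characteristic function.
-- (Every subset of the finite ℓ × r frame is of this form.)
BoolShape : Set
BoolShape = ℕ → ℕ → Bool

⟦_⟧ : BoolShape → Shape
⟦ B ⟧ i j = B i j ≡ true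

InFrame : ℕ → ℕ → Shape → Set
InFrame ℓ r S = ∀ i j → S i j → (1 ≤ i × i ≤ ℓ) × (1 ≤ j × j ≤ r)

IsYoung : ℕ → ℕ → Shape → Set
IsYoung ℓ r S =
  InFrame ℓ r S
  × (∀ i j → S i j → 1 < i → S (i ∸ 1) j)
  × (∀ i j → S i j → 1 < j → S i (j ∸ 1))

bit : Bool → ℕ
bit true  = 1
bit false = 0

card : ℕ → ℕ → BoolShape → ℕ
card ℓ r B = sum (map (λ i → sum (map (λ j → bit (B (suc i) (suc j))) (upTo r))) (upTo ℓ))

OutCorner : BoolShape → ℕ → ℕ → Set
OutCorner B i j = ⟦ B ⟧ i j × ¬ ⟦ B ⟧ i (suc j) × ¬ ⟦ B ⟧ (suc i) j

insert : Shape → ℕ → ℕ → Shape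
insert S a b i j = S i j ⊎ ((i ≡ a) × (j ≡ b))

InCorner : ℕ → ℕ → BoolShape → ℕ → ℕ → Set
InCorner ℓ r B a b =
  ((1 ≤ a × a ≤ ℓ) × (1 ≤ b × b ≤ r)) × ¬ ⟦ B ⟧ a b × IsYoung ℓ r (insert ⟦ B ⟧ a b)

OutBlockMove : ℕ → ℕ → BoolShape → Set
OutBlockMove ℓ r B =
  ∃[ i ] ∃[ j ] ∃[ a ] ∃[ b ] (OutCorner B i j × InCorner ℓ r B a b × i + j < a + b)

-- Young diagram of L_{ℓ,r}(e) with e = q r + c:
-- rows 1..q of length r, and row q+1 of length c
LShape : ℕ → ℕ → ℕ → Shape
LShape r q c i j = ((1 ≤ i × i ≤ q) × (1 ≤ j × j ≤ r)) ⊎ ((i ≡ suc q) × (1 ≤ j × j ≤ c))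

_≐_ : Shape → Shape → Set
S ≐ T = ∀ i j → (S i j → T i j) × (T i j → S i j)

transposeAt : Shape → ℕ → ℕ → Shape
transposeAt S p₁ p₂ x y =
  (S x y × (x < p₁ ⊎ y < p₂))
  ⊎ (∃[ a ] ∃[ b ] (S a b × p₁ ≤ a × p₂ ≤ b × x ≡ b ∸ p₂ + p₁ × y ≡ a ∸ p₁ + p₂))

LegalTranspose : ℕ → ℕ → Shape → ℕ → ℕ → Set
LegalTranspose ℓ r S p₁ p₂ = IsYoung ℓ r (transposeAt S p₁ p₂)

_≲_ : ℕ × ℕ → ℕ × ℕ → Set
(a , b) ≲ (c , d) = a < c ⊎ (a ≡ c × b < d)

_<L_ : Shape → Shape → Set
S <L T = ∃[ a ] ∃[ b ]
  ( (S a b × ¬ T a b)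
  × (∀ c d → (c , d) ≲ (a , b) → (S c d → T c d) × (T c d → S c d)) )

module Submission where

-- Write L i for the length of row i. If a nonempty row is shorter than the row above it, it is
-- as long as the row below it: otherwise its last box and the position just after it would form
-- an out-block move. So every drop in length is followed by a plateau of at least two equal rows.
-- If a plateau of s + 1 rows of length w lies under a row of length P > w and over a row of length
-- g with g + s + 1 ≤ P, transposing an (s + 1) × c rectangle at its right end (1 ≤ c ≤ s) is legal
-- and lengthens the plateau's first row, hence decreases B lexicographically. Apply this to the
-- first row that is not full (which has nonempty rows below it since B is not L(e)): either its
-- plateau fits under the full row above it, or the next plateau fits under its last row, since
-- otherwise the out-corner ending the first plateau and the in-corner ending the second would form
-- an out-block move (or, when the second plateau reaches the bottom of the frame, ℓ ≤ r bounds it).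

open import Defs
open import Data.Nat
  using (ℕ; zero; suc; _+_; _*_; _∸_; _≤_; _<_; z≤n; s≤s; s≤s⁻¹; s<s⁻¹; z<s; _<?_; _≤?_)
open import Data.Nat.Properties
open import Data.Nat.Tactic.RingSolver using (solve-∀)
open import Data.Bool using (true; false)
open import Data.Product using (_×_; _,_; ∃-syntax; proj₁; proj₂)
open import Data.Sum using (_⊎_; inj₁; inj₂; [_,_]′; map₁)
open import Data.Empty using (⊥-elim)
open import Data.List using (map; applyUpTo; upTo)
open import Data.List.Properties using (map-upTo)
open import Data.Nat.ListAction using (sum)
open import Relation.Binary.PropositionalEquality
open import Relation.Nullary using (¬_; Dec; yes; no; contradiction)
open import Relation.Unary using (Decidable)
open import Function using (_∘_)

module _ {P : ℕ → Set} (P? : Decidable P) where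

  least-below : ∀ n → (∃[ t ] (t < n × P t × (∀ u → u < t → ¬ P u))) ⊎ (∀ u → u < n → ¬ P u)
  least-below zero = inj₂ (λ _ ())
  least-below (suc n) with least-below n
  ... | inj₁ (t , t<n , p , minimal) = inj₁ (t , m<n⇒m<1+n t<n , p , minimal)
  ... | inj₂ none with P? n
  ...   | yes p = inj₁ (n , ≤-refl , p , none)
  ...   | no ¬p = inj₂ λ u u<1+n → [ none u , (λ { refl → ¬p }) ]′ (m<1+n⇒m<n∨m≡n u<1+n)

  least : ∀ {N} → P N → ∃[ t ] (t ≤ N × P t × (∀ u → u < t → ¬ P u))
  least {N} p with least-below (suc N)
  ... | inj₁ (t , t<1+N , q , minimal) = t , s≤s⁻¹ t<1+N , q , minimal
  ... | inj₂ none = contradiction p (none N ≤-refl)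

sum-applyUpTo-zero : ∀ n (f : ℕ → ℕ) → (∀ i → f i ≡ 0) → sum (applyUpTo f n) ≡ 0
sum-applyUpTo-zero zero    f zeros = refl
sum-applyUpTo-zero (suc n) f zeros
  rewrite zeros 0 = sum-applyUpTo-zero n (f ∘ suc) (zeros ∘ suc)

sum-applyUpTo-step : ∀ n (f : ℕ → ℕ) K R c →
  (∀ i → i < K → f i ≡ R) → f K ≡ c → (∀ i → K < i → f i ≡ 0) →
  K ≤ n → K < n ⊎ c ≡ 0 → sum (applyUpTo f n) ≡ K * R + c
sum-applyUpTo-step zero    f zero    R c _ _ _ _ (inj₂ c≡0) = sym c≡0
sum-applyUpTo-step (suc n) f zero    R c _ fK≡c zeros _ _ = begin
  f 0 + sum (applyUpTo (f ∘ suc) n)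
    ≡⟨ cong₂ _+_ fK≡c (sum-applyUpTo-zero n (f ∘ suc) (λ i → zeros (suc i) z<s)) ⟩
  c + 0
    ≡⟨ +-identityʳ c ⟩
  c ∎
  where open ≡-Reasoning
sum-applyUpTo-step (suc n) f (suc K) R c full fK≡c zeros (s≤s K≤n) K<n⊎c≡0 = begin
  f 0 + sum (applyUpTo (f ∘ suc) n)
    ≡⟨ cong₂ _+_ (full 0 z<s)
         (sum-applyUpTo-step n (f ∘ suc) K R c (λ i → full (suc i) ∘ s≤s) fK≡c
           (λ i → zeros (suc i) ∘ s≤s) K≤n (map₁ s<s⁻¹ K<n⊎c≡0)) ⟩
  R + (K * R + c)
    ≡⟨ +-assoc R (K * R) c ⟨
  R + K * R + c ∎
  where open ≡-Reasoning

0<m+1+n : ∀ m n → 0 < m + suc n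
0<m+1+n m n = ≤-trans (s≤s z≤n) (m≤n+m (suc n) m)

<⇒≤∸1 : ∀ {m n} → m < n → m ≤ n ∸ 1
<⇒≤∸1 {n = suc n} m<1+n = s≤s⁻¹ m<1+n

[m∸n+o]∸1≡m∸1∸n+o : ∀ m n o → n < m → m ∸ n + o ∸ 1 ≡ m ∸ 1 ∸ n + o
[m∸n+o]∸1≡m∸1∸n+o m n o n<m = begin
  m ∸ n + o ∸ 1   ≡⟨ +-∸-comm o (m<n⇒0<n∸m n<m) ⟩
  m ∸ n ∸ 1 + o   ≡⟨ cong (_+ o) (∸-+-assoc m n 1) ⟩
  m ∸ (n + 1) + o ≡⟨ cong (λ k → m ∸ k + o) (+-comm n 1) ⟩
  m ∸ (1 + n) + o ≡⟨ cong (_+ o) (∸-+-assoc m 1 n) ⟨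
  m ∸ 1 ∸ n + o   ∎
  where open ≡-Reasoning

2+n+t+1+g≤n+m⇒g+1+t≤m : ∀ n t g m → suc (suc (n + t)) + suc g ≤ n + m → g + suc t ≤ m
2+n+t+1+g≤n+m⇒g+1+t≤m n t g m le =
  +-cancelˡ-≤ n (g + suc t) m (≤-trans (m≤m+n (n + (g + suc t)) 2) (≤-trans (≤-reflexive (eq n t g)) le))
  where
  eq : ∀ n t g → n + (g + suc t) + 2 ≡ suc (suc (n + t)) + suc g
  eq = solve-∀

1+a+h+t<g+1+h⇒1+t≤g : ∀ a h t g → 1 ≤ a → suc (a + h) + t < g + suc h → suc t ≤ g
1+a+h+t<g+1+h⇒1+t≤g (suc a) h t g _ lt =
  +-cancelʳ-≤ (suc h) (suc t) g
    (≤-trans (m≤m+n (suc t + suc h) (suc a)) (≤-trans (≤-reflexive (eq a h t)) lt))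
  where
  eq : ∀ a h t → suc t + suc h + suc a ≡ suc (suc (suc a + h) + t)
  eq = solve-∀

-- Where to cut a plateau of s + 1 rows of length w, lying over a row of length g and under one of
-- length P: its last c columns are the rectangle to transpose.
column-split : ∀ {w g s P} → g < w → 1 ≤ s → g + suc s ≤ P → w < P →
  ∃[ J ] ∃[ c ] (J + c ≡ w × g ≤ J × 1 ≤ c × c ≤ s × J + suc s ≤ P)
column-split {w} {g} {s} {P} g<w 1≤s g+s<P w<P with w ∸ g ≤? s
... | yes w∸g≤s = g , w ∸ g , m+[n∸m]≡n (<⇒≤ g<w) , ≤-refl , m<n⇒0<n∸m g<w , w∸g≤s , g+s<P
... | no w∸g≰s = w ∸ s , s , m∸n+n≡m s≤w , m+n≤o⇒m≤o∸n g g+s≤w , 1≤s , ≤-refl , room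
  where
  g+s≤w : g + s ≤ w
  g+s≤w = <⇒≤ (subst (g + s <_) (m+[n∸m]≡n (<⇒≤ g<w)) (+-monoʳ-< g (≰⇒> w∸g≰s)))
  s≤w : s ≤ w
  s≤w = ≤-trans (m≤n+m s g) g+s≤w
  room : w ∸ s + suc s ≤ P
  room = subst (_≤ P) (sym (trans (+-suc (w ∸ s) s) (cong suc (m∸n+n≡m s≤w)))) w<P

rowLength : BoolShape → ℕ → ℕ → ℕ
rowLength B i zero = zero
rowLength B i (suc n) with B i (suc n)
... | true  = suc n
... | false = rowLength B i n

rowLength-≤ : ∀ B i n → rowLength B i n ≤ n
rowLength-≤ B i zero = z≤n
rowLength-≤ B i (suc n) with B i (suc n)
... | true  = ≤-refl
... | false = m≤n⇒m≤1+n (rowLength-≤ B i n)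

rowLength-maximal : ∀ B i n {j} → ⟦ B ⟧ i j → j ≤ n → j ≤ rowLength B i n
rowLength-maximal B i zero    _   j≤0   = j≤0
rowLength-maximal B i (suc n) box j≤1+n with B i (suc n) in eq
... | true  = j≤1+n
... | false with m≤n⇒m<n∨m≡n j≤1+n
...   | inj₁ j<1+n = rowLength-maximal B i n box (s≤s⁻¹ j<1+n)
...   | inj₂ refl  = contradiction (trans (sym box) eq) λ ()

rowLength-attained : ∀ B i n → rowLength B i n ≡ 0 ⊎ ⟦ B ⟧ i (rowLength B i n)
rowLength-attained B i zero = inj₁ refl
rowLength-attained B i (suc n) with B i (suc n) in eq
... | true  = inj₂ eq
... | false = rowLength-attained B i n

LegalDecreasingTranspose : ℕ → ℕ → BoolShape → Set
LegalDecreasingTranspose ℓ r B =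
  ∃[ i ] ∃[ j ] (⟦ B ⟧ i j × LegalTranspose ℓ r ⟦ B ⟧ i j × (transposeAt ⟦ B ⟧ i j <L ⟦ B ⟧))

module Rows (ℓ r : ℕ) (B : BoolShape) (young : IsYoung ℓ r ⟦ B ⟧) where

  in-frame : InFrame ℓ r ⟦ B ⟧
  in-frame = proj₁ young

  up-closed : ∀ i j → ⟦ B ⟧ i j → 1 < i → ⟦ B ⟧ (i ∸ 1) j
  up-closed = proj₁ (proj₂ young)

  left-closed : ∀ i j → ⟦ B ⟧ i j → 1 < j → ⟦ B ⟧ i (j ∸ 1)
  left-closed = proj₂ (proj₂ young)

  -- Row 0 counts as a full row, so the first row sits below a row of length r like any other.
  L : ℕ → ℕ
  L zero    = r
  L (suc i) = rowLength B (suc i) r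

  L≤r : ∀ i → L i ≤ r
  L≤r zero    = ≤-refl
  L≤r (suc i) = rowLength-≤ B (suc i) r

  box⇒≤L : ∀ {i j} → ⟦ B ⟧ i j → 1 ≤ i × 1 ≤ j × j ≤ L i
  box⇒≤L {i} {j} box with in-frame i j box
  box⇒≤L {suc i} box | _ , (1≤j , j≤r) = s≤s z≤n , 1≤j , rowLength-maximal B (suc i) r box j≤r

  left-closed* : ∀ {i} b {j} → ⟦ B ⟧ i b → 1 ≤ j → j ≤ b → ⟦ B ⟧ i j
  left-closed* zero    _   1≤j j≤0 = contradiction (≤-trans 1≤j j≤0) λ ()
  left-closed* {i} (suc b) box 1≤j j≤1+b with m≤n⇒m<n∨m≡n j≤1+b
  ... | inj₂ refl   = box
  ... | inj₁ j<1+b =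
    left-closed* b (left-closed i (suc b) box (s≤s (≤-trans 1≤j (s≤s⁻¹ j<1+b)))) 1≤j (s≤s⁻¹ j<1+b)

  ≤L⇒box : ∀ {i j} → 1 ≤ i → 1 ≤ j → j ≤ L i → ⟦ B ⟧ i j
  ≤L⇒box {suc i} {j} _ 1≤j j≤L with rowLength-attained B (suc i) r
  ... | inj₁ L≡0 = contradiction (≤-trans 1≤j (subst (j ≤_) L≡0 j≤L)) λ ()
  ... | inj₂ box = left-closed* _ box 1≤j j≤L

  L-beyond-frame : ∀ {i} → ℓ < i → L i ≡ 0
  L-beyond-frame {suc i} ℓ<i with rowLength-attained B (suc i) r
  ... | inj₁ L≡0 = L≡0
  ... | inj₂ box = contradiction (proj₂ (proj₁ (in-frame (suc i) _ box))) (<⇒≱ ℓ<i)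

  0<L⇒≤ℓ : ∀ {i} → 0 < L i → i ≤ ℓ
  0<L⇒≤ℓ {i} 0<L with ℓ <? i
  ... | yes ℓ<i = contradiction (subst (0 <_) (L-beyond-frame ℓ<i) 0<L) λ ()
  ... | no ℓ≮i = ≮⇒≥ ℓ≮i

  L-suc-≤ : ∀ i → L (suc i) ≤ L i
  L-suc-≤ zero = L≤r 1
  L-suc-≤ (suc i) with rowLength-attained B (suc (suc i)) r
  ... | inj₁ L≡0 = subst (_≤ L (suc i)) (sym L≡0) z≤n
  ... | inj₂ box = proj₂ (proj₂ (box⇒≤L (up-closed (suc (suc i)) _ box (s≤s (s≤s z≤n)))))

  L-antitone : ∀ {i i'} → i ≤ i' → L i' ≤ L i
  L-antitone {i' = zero} z≤n = ≤-refl
  L-antitone {i' = suc i'} i≤1+i' with m≤n⇒m<n∨m≡n i≤1+i'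
  ... | inj₁ i<1+i' = ≤-trans (L-suc-≤ i') (L-antitone (s≤s⁻¹ i<1+i'))
  ... | inj₂ refl   = ≤-refl

  outCorner-at-end : ∀ a → 1 ≤ a → 1 ≤ L a → L (suc a) < L a → OutCorner B a (L a)
  outCorner-at-end a 1≤a 1≤La La+1<La =
    ≤L⇒box 1≤a 1≤La ≤-refl ,
    (λ box → n≮n _ (proj₂ (proj₂ (box⇒≤L box)))) ,
    (λ box → n≮n _ (≤-<-trans (proj₂ (proj₂ (box⇒≤L box))) La+1<La))

  inCorner-after-end : ∀ a → 1 ≤ a → a ≤ ℓ → L a < L (a ∸ 1) → InCorner ℓ r B a (suc (L a))
  inCorner-after-end a 1≤a a≤ℓ La<La-1 =
    ((1≤a , a≤ℓ) , (s≤s z≤n , La<r)) ,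
    (λ box → n≮n _ (proj₂ (proj₂ (box⇒≤L box)))) ,
    frame , up , left
    where
    La<r : L a < r
    La<r = ≤-trans La<La-1 (L≤r (a ∸ 1))
    B⁺ : Shape
    B⁺ = insert ⟦ B ⟧ a (suc (L a))
    frame : InFrame ℓ r B⁺
    frame i j (inj₁ box) = in-frame i j box
    frame i j (inj₂ (refl , refl)) = (1≤a , a≤ℓ) , (s≤s z≤n , La<r)
    up : ∀ i j → B⁺ i j → 1 < i → B⁺ (i ∸ 1) j
    up i j (inj₁ box) 1<i = inj₁ (up-closed i j box 1<i)
    up i j (inj₂ (refl , refl)) 1<a = inj₁ (≤L⇒box (<⇒≤∸1 1<a) (s≤s z≤n) La<La-1)
    left : ∀ i j → B⁺ i j → 1 < j → B⁺ i (j ∸ 1)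
    left i j (inj₁ box) 1<j = inj₁ (left-closed i j box 1<j)
    left i j (inj₂ (refl , refl)) 1<j = inj₁ (≤L⇒box 1≤a (s≤s⁻¹ 1<j) ≤-refl)

  row-card : ∀ i → sum (map (λ j → bit (B (suc i) (suc j))) (upTo r)) ≡ L (suc i)
  row-card i = begin
    sum (map f (upTo r))  ≡⟨ cong sum (map-upTo f r) ⟩
    sum (applyUpTo f r)   ≡⟨ sum-applyUpTo-step r f (L (suc i)) 1 0 inside (outside _ ≤-refl)
                               (λ j → outside j ∘ <⇒≤) (L≤r (suc i)) (inj₂ refl) ⟩
    L (suc i) * 1 + 0     ≡⟨ +-identityʳ _ ⟩
    L (suc i) * 1         ≡⟨ *-identityʳ _ ⟩
    L (suc i)             ∎
    where
    open ≡-Reasoning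
    f : ℕ → ℕ
    f j = bit (B (suc i) (suc j))
    inside : ∀ j → j < L (suc i) → f j ≡ 1
    inside j j<L rewrite ≤L⇒box (s≤s z≤n) (s≤s z≤n) j<L = refl
    outside : ∀ j → L (suc i) ≤ j → f j ≡ 0
    outside j L≤j with B (suc i) (suc j) in box
    ... | true  = contradiction (proj₂ (proj₂ (box⇒≤L box))) (<⇒≱ (s≤s L≤j))
    ... | false = refl

  first-short-row : 1 ≤ r →
    ∃[ K ] (K ≤ ℓ × L K ≡ r × L (suc K) < r × (∀ i → 1 ≤ i → i ≤ K → L i ≡ r))
  first-short-row 1≤r with least (λ i → L (suc i) <? r) {N = ℓ}
                             (subst (_< r) (sym (L-beyond-frame ≤-refl)) 1≤r)
  ... | K , K≤ℓ , short , longer-before = K , K≤ℓ , full-above K ≤-refl , short , full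
    where
    full : ∀ i → 1 ≤ i → i ≤ K → L i ≡ r
    full (suc i) _ i<K = ≤-antisym (L≤r (suc i)) (≮⇒≥ (longer-before i i<K))
    full-above : ∀ i → i ≤ K → L i ≡ r
    full-above zero    _   = refl
    full-above (suc i) i<K = full (suc i) (s≤s z≤n) i<K

  module _ {K} (K≤ℓ : K ≤ ℓ) (full : ∀ i → 1 ≤ i → i ≤ K → L i ≡ r)
           (empty : L (suc (suc K)) ≡ 0) where

    L-below-empty : ∀ {i} → suc K < i → L i ≡ 0
    L-below-empty {i} K+1<i = n≤0⇒n≡0 (subst (L i ≤_) empty (L-antitone K+1<i))

    card-LShape : card ℓ r B ≡ K * r + L (suc K)
    card-LShape = begin
      card ℓ r B           ≡⟨ cong sum (map-upTo F ℓ) ⟩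
      sum (applyUpTo F ℓ)  ≡⟨ sum-applyUpTo-step ℓ F K r (L (suc K))
                                (λ i i<K → trans (row-card i) (full (suc i) (s≤s z≤n) i<K))
                                (row-card K)
                                (λ i K<i → trans (row-card i) (L-below-empty (s≤s K<i)))
                                K≤ℓ last-row ⟩
      K * r + L (suc K)    ∎
      where
      open ≡-Reasoning
      F : ℕ → ℕ
      F i = sum (map (λ j → bit (B (suc i) (suc j))) (upTo r))
      last-row : K < ℓ ⊎ L (suc K) ≡ 0
      last-row with m≤n⇒m<n∨m≡n K≤ℓ
      ... | inj₁ K<ℓ = inj₁ K<ℓ
      ... | inj₂ refl = inj₂ (L-beyond-frame ≤-refl)

    ≐-LShape : ⟦ B ⟧ ≐ LShape r K (L (suc K))
    ≐-LShape i j = to , from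
      where
      to : ⟦ B ⟧ i j → LShape r K (L (suc K)) i j
      to box with box⇒≤L box
      ... | 1≤i , 1≤j , j≤L with i ≤? K
      ...   | yes i≤K = inj₁ ((1≤i , i≤K) , (1≤j , ≤-trans j≤L (L≤r i)))
      ...   | no i≰K with m≤n⇒m<n∨m≡n (≰⇒> i≰K)
      ...     | inj₂ refl = inj₂ (refl , 1≤j , j≤L)
      ...     | inj₁ K+1<i = contradiction (subst (j ≤_) (L-below-empty K+1<i) j≤L) (<⇒≱ 1≤j)
      from : LShape r K (L (suc K)) i j → ⟦ B ⟧ i j
      from (inj₁ ((1≤i , i≤K) , (1≤j , j≤r))) =
        ≤L⇒box 1≤i 1≤j (subst (j ≤_) (sym (full i 1≤i i≤K)) j≤r)
      from (inj₂ (refl , 1≤j , j≤L)) = ≤L⇒box (s≤s z≤n) 1≤j j≤L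

  -- The transpose at (suc A , suc J) turns the (s + 1) × c rectangle at the right end of the
  -- plateau into a c × (s + 1) rectangle, which fits under row A and lengthens row suc A.
  module RectangleTranspose (A J c s : ℕ)
    (level : ∀ u → u ≤ s → L (suc A + u) ≡ J + c) (below : L (suc (suc A + s)) ≤ J)
    (1≤c : 1 ≤ c) (c≤s : c ≤ s) (room : J + suc s ≤ L A) where

    a j : ℕ
    a = suc A
    j = suc J

    T : Shape
    T = transposeAt ⟦ B ⟧ a j

    row-in-rectangle : ∀ {a'} → a ≤ a' → a' ∸ a ≤ s → L a' ≡ J + c
    row-in-rectangle {a'} a≤a' u≤s = subst (λ k → L k ≡ J + c) (m+[n∸m]≡n a≤a') (level (a' ∸ a) u≤s)

    L-a : L a ≡ J + c
    L-a = subst (λ k → L k ≡ J + c) (+-identityʳ a) (level 0 z≤n)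

    j≤J+c : j ≤ J + c
    j≤J+c = subst (_≤ J + c) (+-comm J 1) (+-monoʳ-≤ J 1≤c)

    quadrant : ∀ {a' b'} → ⟦ B ⟧ a' b' → a ≤ a' → j ≤ b' → a' ∸ a ≤ s × b' ≤ J + c
    quadrant {a'} {b'} box a≤a' j≤b' = rows , subst (b' ≤_) (row-in-rectangle a≤a' rows) b'≤L
      where
      b'≤L : b' ≤ L a'
      b'≤L = proj₂ (proj₂ (box⇒≤L box))
      below-rectangle : s < a' ∸ a → suc (a + s) ≤ a'
      below-rectangle s<u = subst (suc (a + s) ≤_) (m+[n∸m]≡n a≤a') (+-monoʳ-< a s<u)
      rows : a' ∸ a ≤ s
      rows = ≮⇒≥ λ s<u → <⇒≱ j≤b' (≤-trans b'≤L (≤-trans (L-antitone (below-rectangle s<u)) below))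

    col-offset<c : ∀ {b'} → j ≤ b' → b' ≤ J + c → b' ∸ j < c
    col-offset<c {b'} j≤b' b'≤J+c = subst (b' ∸ j <_) (m+n∸m≡n J c) (∸-monoˡ-< (s≤s b'≤J+c) j≤b')

    transposed-row-length : ∀ {b'} → j ≤ b' → b' ≤ J + c → L (b' ∸ j + a) ≡ J + c
    transposed-row-length {b'} j≤b' b'≤J+c =
      subst (λ k → L k ≡ J + c) (+-comm a (b' ∸ j))
        (level (b' ∸ j) (<⇒≤ (<-≤-trans (col-offset<c j≤b' b'≤J+c) c≤s)))

    transposed-col-fits : ∀ {u} → u ≤ s → u + j ≤ L A
    transposed-col-fits {u} u≤s = ≤-trans (≤-trans (+-monoˡ-≤ j u≤s) (≤-reflexive s+j≡J+1+s)) room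
      where
      s+j≡J+1+s : s + j ≡ J + suc s
      s+j≡J+1+s = trans (+-comm s j) (sym (+-suc J s))

    T-in-frame : InFrame ℓ r T
    T-in-frame x y (inj₁ (box , _)) = in-frame x y box
    T-in-frame _ _ (inj₂ (a' , b' , box , a≤a' , j≤b' , refl , refl)) =
      (0<m+1+n (b' ∸ j) A , 0<L⇒≤ℓ (subst (0 <_) (sym (transposed-row-length j≤b' (proj₂ q))) 0<J+c)) ,
      (0<m+1+n (a' ∸ a) J , ≤-trans (transposed-col-fits (proj₁ q)) (L≤r A))
      where
      q : a' ∸ a ≤ s × b' ≤ J + c
      q = quadrant box a≤a' j≤b'
      0<J+c : 0 < J + c
      0<J+c = ≤-trans 1≤c (m≤n+m c J)

    T-up-closed : ∀ x y → T x y → 1 < x → T (x ∸ 1) y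
    T-up-closed x y (inj₁ (box , inj₁ x<a)) 1<x =
      inj₁ (up-closed x y box 1<x , inj₁ (≤-<-trans (m∸n≤m x 1) x<a))
    T-up-closed x y (inj₁ (box , inj₂ y<j)) 1<x = inj₁ (up-closed x y box 1<x , inj₂ y<j)
    T-up-closed _ _ (inj₂ (a' , b' , box , a≤a' , j≤b' , refl , refl)) 1<x with j <? b'
    ... | yes j<b' =
      inj₂ (a' , b' ∸ 1 , left-closed a' b' box (≤-<-trans (s≤s z≤n) j<b') , a≤a' , <⇒≤∸1 j<b' ,
            [m∸n+o]∸1≡m∸1∸n+o b' j a j<b' , refl)
    ... | no j≮b' =
      subst (λ k → T (k ∸ 1) (a' ∸ a + j)) (sym x≡a)
        (inj₁ (≤L⇒box (s≤s⁻¹ (subst (1 <_) x≡a 1<x)) (0<m+1+n (a' ∸ a) J)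
                 (transposed-col-fits (proj₁ (quadrant box a≤a' j≤b'))) , inj₁ ≤-refl))
      where
      x≡a : b' ∸ j + a ≡ a
      x≡a = cong (_+ a) (trans (cong (_∸ j) (≤-antisym (≮⇒≥ j≮b') j≤b')) (n∸n≡0 j))

    T-left-closed : ∀ x y → T x y → 1 < y → T x (y ∸ 1)
    T-left-closed x y (inj₁ (box , inj₁ x<a)) 1<y = inj₁ (left-closed x y box 1<y , inj₁ x<a)
    T-left-closed x y (inj₁ (box , inj₂ y<j)) 1<y =
      inj₁ (left-closed x y box 1<y , inj₂ (≤-<-trans (m∸n≤m y 1) y<j))
    T-left-closed _ _ (inj₂ (a' , b' , box , a≤a' , j≤b' , refl , refl)) 1<y with a <? a'
    ... | yes a<a' =
      inj₂ (a' ∸ 1 , b' , up-closed a' b' box (≤-<-trans (s≤s z≤n) a<a') , <⇒≤∸1 a<a' , j≤b' ,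
            refl , [m∸n+o]∸1≡m∸1∸n+o a' a j a<a')
    ... | no a≮a' =
      subst (λ k → T (b' ∸ j + a) (k ∸ 1)) (sym y≡j)
        (inj₁ (≤L⇒box (0<m+1+n (b' ∸ j) A) (s≤s⁻¹ (subst (1 <_) y≡j 1<y))
                 (subst (J ≤_) (sym (transposed-row-length j≤b' (proj₂ (quadrant box a≤a' j≤b'))))
                    (m≤m+n J c)) , inj₂ ≤-refl))
      where
      y≡j : a' ∸ a + j ≡ j
      y≡j = cong (_+ j) (trans (cong (_∸ a) (≤-antisym (≮⇒≥ a≮a') a≤a')) (n∸n≡0 a))

    image-of-column-j : ∀ {u} → u ≤ s → T a (u + j)
    image-of-column-j {u} u≤s =
      inj₂ (a + u , j , ≤L⇒box (s≤s z≤n) (s≤s z≤n) (subst (j ≤_) (sym (level u u≤s)) j≤J+c) ,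
            m≤m+n a u , ≤-refl , sym (cong (_+ a) (n∸n≡0 j)) , cong (_+ j) (sym (m+n∸m≡n a u)))

    new-box : T a (suc (J + c))
    new-box = subst (T a) (trans (+-suc c J) (cong suc (+-comm c J))) (image-of-column-j c≤s)

    new-box-∉B : ¬ ⟦ B ⟧ a (suc (J + c))
    new-box-∉B box = n≮n _ (subst (suc (J + c) ≤_) L-a (proj₂ (proj₂ (box⇒≤L box))))

    agree-before-new-box : ∀ x y → (x , y) ≲ (a , suc (J + c)) →
      (T x y → ⟦ B ⟧ x y) × (⟦ B ⟧ x y → T x y)
    agree-before-new-box x y (inj₁ x<a) = T⇒B , λ box → inj₁ (box , inj₁ x<a)
      where
      T⇒B : T x y → ⟦ B ⟧ x y
      T⇒B (inj₁ (box , _)) = box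
      T⇒B (inj₂ (_ , b' , _ , _ , _ , x≡ , _)) =
        contradiction (subst (a ≤_) (sym x≡) (m≤n+m a (b' ∸ j))) (<⇒≱ x<a)
    agree-before-new-box _ y (inj₂ (refl , y≤J+c)) = T⇒B , B⇒T
      where
      T⇒B : T a y → ⟦ B ⟧ a y
      T⇒B (inj₁ (box , _)) = box
      T⇒B (inj₂ (a' , _ , _ , _ , _ , _ , y≡)) =
        ≤L⇒box (s≤s z≤n) (subst (1 ≤_) (sym y≡) (0<m+1+n (a' ∸ a) J))
          (subst (y ≤_) (sym L-a) (s≤s⁻¹ y≤J+c))
      B⇒T : ⟦ B ⟧ a y → T a y
      B⇒T box with y <? j
      ... | yes y<j = inj₁ (box , inj₂ y<j)
      ... | no y≮j  = subst (T a) (m∸n+n≡m (≮⇒≥ y≮j))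
                        (image-of-column-j (<⇒≤ (<-≤-trans (col-offset<c (≮⇒≥ y≮j) (s≤s⁻¹ y≤J+c)) c≤s)))

    legal-and-smaller : ⟦ B ⟧ a j × LegalTranspose ℓ r ⟦ B ⟧ a j × (T <L ⟦ B ⟧)
    legal-and-smaller =
      ≤L⇒box (s≤s z≤n) (s≤s z≤n) (subst (j ≤_) (sym L-a) j≤J+c) ,
      (T-in-frame , T-up-closed , T-left-closed) ,
      (a , suc (J + c) , (new-box , new-box-∉B) , agree-before-new-box)

  record Plateau (a : ℕ) : Set where
    field
      last  : ℕ
      level : ∀ u → u ≤ last → L (a + u) ≡ L a
      drop  : L (suc (a + last)) < L a

    below : ℕ
    below = L (suc (a + last))

  find-plateau : ∀ a → 0 < L a → Plateau a
  find-plateau a 0<La with least (λ u → L (suc (a + u)) <? L a) {N = ℓ}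
                             (subst (_< L a) (sym (L-beyond-frame (s≤s (m≤n+m ℓ a)))) 0<La)
  ... | t , _ , drop , not-before = record { last = t ; level = level ; drop = drop }
    where
    level : ∀ u → u ≤ t → L (a + u) ≡ L a
    level zero    _   = cong L (+-identityʳ a)
    level (suc u) u<t = ≤-antisym (L-antitone (m≤m+n a (suc u)))
                          (subst (L a ≤_) (cong L (sym (+-suc a u))) (≮⇒≥ (not-before u u<t)))

  open Plateau

  overhang⇒below-nonempty : ℓ ≤ r → ∀ {a} (p : Plateau a) → 1 ≤ a →
    r < below p + suc (last p) → 0 < below p
  overhang⇒below-nonempty ℓ≤r {a} p 1≤a overhang =
    +-cancelʳ-< (suc (last p)) 0 (below p)
      (≤-<-trans (≤-trans (+-monoˡ-≤ (last p) 1≤a) (≤-trans (0<L⇒≤ℓ 0<L-last) ℓ≤r)) overhang)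
    where
    0<L-last : 0 < L (a + last p)
    0<L-last = subst (0 <_) (sym (level p (last p) ≤-refl)) (≤-<-trans z≤n (drop p))

  module _ (no-move : ¬ OutBlockMove ℓ r B) (ℓ≤r : ℓ ≤ r) where

    corner-sum : ∀ {a b} → 1 ≤ a → 0 < L a → L (suc a) < L a →
      1 ≤ b → b ≤ ℓ → L b < L (b ∸ 1) → b + suc (L b) ≤ a + L a
    corner-sum {a} {b} 1≤a 0<La drop-a 1≤b b≤ℓ rise-b = ≮⇒≥ λ lt →
      no-move (a , L a , b , suc (L b) ,
               outCorner-at-end a 1≤a 0<La drop-a , inCorner-after-end b 1≤b b≤ℓ rise-b , lt)

    plateau-after-drop : ∀ {a} → 1 ≤ a → 0 < L a → L a < L (a ∸ 1) → L (suc a) ≡ L a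
    plateau-after-drop {a} 1≤a 0<La La<La-1 with m≤n⇒m<n∨m≡n (L-suc-≤ a)
    ... | inj₂ same = same
    ... | inj₁ drop-a = contradiction (corner-sum 1≤a 0<La drop-a 1≤a (0<L⇒≤ℓ 0<La) La<La-1)
                                      (<⇒≱ (+-monoʳ-< a (n<1+n (L a))))

    tall-plateau : ∀ {A} (p : Plateau (suc A)) → L (suc A) < L A → 1 ≤ last p
    tall-plateau {A} record { last = zero ; drop = drop-p } L<LA =
      contradiction (subst (_< L (suc A)) (trans (cong (L ∘ suc) (+-identityʳ (suc A))) flat) drop-p) (n≮n _)
      where
      flat : L (suc (suc A)) ≡ L (suc A)
      flat = plateau-after-drop (s≤s z≤n) (≤-<-trans z≤n drop-p) L<LA
    tall-plateau record { last = suc _ } _ = s≤s z≤n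

    transpose-at-plateau : ∀ A (p : Plateau (suc A)) → L (suc A) < L A →
      below p + suc (last p) ≤ L A → LegalDecreasingTranspose ℓ r B
    transpose-at-plateau A p L<LA room with column-split (drop p) (tall-plateau p L<LA) room L<LA
    ... | J , c , J+c≡L , below≤J , 1≤c , c≤s , room′ =
      suc A , suc J ,
      RectangleTranspose.legal-and-smaller A J c (last p)
        (λ u u≤s → trans (level p u u≤s) (sym J+c≡L)) below≤J 1≤c c≤s room′

    second-plateau-fits : ∀ {a} (p : Plateau a) → 1 ≤ a → r < below p + suc (last p) →
      (q : Plateau (suc (a + last p))) → below q + suc (last q) ≤ L (a + last p)
    second-plateau-fits {a} p 1≤a overhang q = by-frame (suc (suc (a + last p) + last q) ≤? ℓ)
      where
      L-last : L (a + last p) ≡ L a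
      L-last = level p (last p) ≤-refl
      drop′ : below p < L (a + last p)
      drop′ = subst (below p <_) (sym L-last) (drop p)
      0<L-last : 0 < L (a + last p)
      0<L-last = ≤-<-trans z≤n drop′
      rise : below q < L (suc (a + last p) + last q)
      rise = subst (below q <_) (sym (level q (last q) ≤-refl)) (drop q)
      by-frame : Dec (suc (suc (a + last p) + last q) ≤ ℓ) → below q + suc (last q) ≤ L (a + last p)
      by-frame (yes in-frame′) =
        2+n+t+1+g≤n+m⇒g+1+t≤m (a + last p) (last q) (below q) (L (a + last p))
          (corner-sum (≤-trans 1≤a (m≤m+n a (last p))) 0<L-last drop′ (s≤s z≤n) in-frame′ rise)
      by-frame (no beyond) =
        subst (λ k → k + suc (last q) ≤ L (a + last p)) (sym (L-beyond-frame (≰⇒> beyond)))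
          (<⇒≤ (≤-<-trans (1+a+h+t<g+1+h⇒1+t≤g a (last p) (last q) (below p) 1≤a
                              (≤-<-trans (≤-trans (0<L⇒≤ℓ 0<L-row) ℓ≤r) overhang)) drop′))
        where
        0<L-row : 0 < L (suc (a + last p) + last q)
        0<L-row = subst (0 <_) (sym (level q (last q) ≤-refl))
                    (overhang⇒below-nonempty ℓ≤r p 1≤a overhang)

    transpose-below-full-row : ∀ {K} → L K ≡ r → L (suc K) < r → 0 < L (suc K) →
      LegalDecreasingTranspose ℓ r B
    transpose-below-full-row {K} LK≡r short 0<L = by-room (below p + suc (last p) ≤? r)
      where
      p : Plateau (suc K)
      p = find-plateau (suc K) 0<L
      by-room : Dec (below p + suc (last p) ≤ r) → LegalDecreasingTranspose ℓ r B
      by-room (yes fits) =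
        transpose-at-plateau K p (subst (L (suc K) <_) (sym LK≡r) short)
          (subst (below p + suc (last p) ≤_) (sym LK≡r) fits)
      by-room (no ¬fits) =
        transpose-at-plateau (suc K + last p) q
          (subst (below p <_) (sym (level p (last p) ≤-refl)) (drop p))
          (second-plateau-fits p (s≤s z≤n) overhang q)
        where
        overhang : r < below p + suc (last p)
        overhang = ≰⇒> ¬fits
        q : Plateau (suc (suc K + last p))
        q = find-plateau _ (overhang⇒below-nonempty ℓ≤r p (s≤s z≤n) overhang)

lemma3p5 : (ℓ r : ℕ) → 1 ≤ r → ℓ ≤ r → (B : BoolShape) → IsYoung ℓ r ⟦ B ⟧ →
    ¬ OutBlockMove ℓ r B →
    (∀ q c → card ℓ r B ≡ q * r + c → c < r → ¬ (⟦ B ⟧ ≐ LShape r q c)) →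
    ∃[ i ] ∃[ j ] (⟦ B ⟧ i j × LegalTranspose ℓ r ⟦ B ⟧ i j × (transposeAt ⟦ B ⟧ i j <L ⟦ B ⟧))
lemma3p5 ℓ r 1≤r ℓ≤r B young no-move not-L = below-first-short-row (first-short-row 1≤r)
  where
  open Rows ℓ r B young
  below-first-short-row :
    ∃[ K ] (K ≤ ℓ × L K ≡ r × L (suc K) < r × (∀ i → 1 ≤ i → i ≤ K → L i ≡ r)) →
    LegalDecreasingTranspose ℓ r B
  below-first-short-row (K , K≤ℓ , LK≡r , short , full) with 1 ≤? L (suc (suc K))
  ... | yes 0<L = transpose-below-full-row no-move ℓ≤r LK≡r short (≤-trans 0<L (L-suc-≤ (suc K)))
  ... | no L≯0 =
    ⊥-elim (not-L K (L (suc K)) (card-LShape K≤ℓ full empty) short (≐-LShape K≤ℓ full empty))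
    where
    empty : L (suc (suc K)) ≡ 0
    empty = n≤0⇒n≡0 (≮⇒≥ L≯0)
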